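{- Let $S\subseteq\mathbb{Z}^2$ be an antimatroidal point set, and let $x_{\max},y_{\max}$ be the maximum $x$- and $y$-coordinates of points of $S$. List the points of $\mathcal{B}_{lower}$ in lexicographic order as $B_0,B_1,\dots,B_k$. Then $B_0=(0,0)$, $B_k=(x_{\max},y_{\max})$, and $B_i\subset B_{i+1}$ for all $0\le i<k$ (the lower boundary is a monotone increasing path between $(0,0)$ and $(x_{\max},y_{\max})$).
   Context: A point $A=(x_A,y_A)\in\mathbb{Z}^2$ is regarded as a multiset over $\{x,y\}$; $A\subseteq B$ means $x_A\le x_B$ and $y_A\le y_B$; $A\subset B$ means $A\subseteq B$ and $A\ne B$. A finite nonempty set $S\subseteq\mathbb{Z}^2$ is an antimatroidal point set if (A1) for every $(x_A,y_A)\in S$ with $(x_A,y_A)\neq(0,0)$, either $(x_A-1,y_A)\in S$ or $(x_A,y_A-1)\in S$; (A2) for all $A,B\in S$ with $A\not\subseteq B$: if $x_A\ge x_B$ and $y_A\ge y_B$ then $(x_B+1,y_B)\in S$ or $(x_B,y_B+1)\in S$; if $x_A\le x_B$ and $y_A\ge y_B$ then $(x_B,y_B+1)\in S$; if $x_A\ge x_B$ and $y_A\le y_B$ then $(x_B+1,y_B)\in S$. The lower boundary is $\mathcal{B}_{lower}=\{(x,y)\in S:(x+1,y)\notin S\ \vee\ (x,y-1)\notin S\ \vee\ (x+1,y-1)\notin S\}$. -}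

module Defs where

open import Data.Integer using (ℤ; _+_; _-_; _≤_; _<_; 0ℤ; 1ℤ)
open import Data.Product using (_×_; _,_; proj₁; proj₂; ∃-syntax)
open import Data.Sum using (_⊎_)
open import Data.List using (List)
open import Data.List.Membership.Propositional using (_∈_)
open import Relation.Binary.PropositionalEquality using (_≡_; _≢_)
open import Relation.Nullary using (¬_)

-- A point of ℤ², viewed as a multiset over {x, y}.
Point : Set
Point = ℤ × ℤ

xc : Point → ℤ
xc = proj₁

yc : Point → ℤ
yc = proj₂

_⊆ₚ_ : Point → Point → Set
A ⊆ₚ B = (xc A ≤ xc B) × (yc A ≤ yc B)

_⊂ₚ_ : Point → Point → Set
A ⊂ₚ B = (A ⊆ₚ B) × (A ≢ B)

-- A finite set S ⊆ ℤ² is represented by a list of its points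
-- (membership = list membership; duplicates are irrelevant).
PointSet : Set
PointSet = List Point

_∈S_ : Point → PointSet → Set
p ∈S S = p ∈ S

NonEmpty : PointSet → Set
NonEmpty S = ∃[ p ] (p ∈S S)

A1 : PointSet → Set
A1 S = ∀ A → A ∈S S → A ≢ (0ℤ , 0ℤ) →
  ((xc A - 1ℤ , yc A) ∈S S) ⊎ ((xc A , yc A - 1ℤ) ∈S S)

A2 : PointSet → Set
A2 S = ∀ A B → A ∈S S → B ∈S S → ¬ (A ⊆ₚ B) →
    ((xc A ≥' xc B) → (yc A ≥' yc B) →
       ((xc B + 1ℤ , yc B) ∈S S) ⊎ ((xc B , yc B + 1ℤ) ∈S S))
  × ((xc A ≤ xc B) → (yc A ≥' yc B) → (xc B , yc B + 1ℤ) ∈S S)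
  × ((xc A ≥' xc B) → (yc A ≤ yc B) → (xc B + 1ℤ , yc B) ∈S S)
  where
  _≥'_ : ℤ → ℤ → Set
  a ≥' b = b ≤ a

IsAntimatroidal : PointSet → Set
IsAntimatroidal S = NonEmpty S × A1 S × A2 S

InLower : PointSet → Point → Set
InLower S p = p ∈S S ×
  ( ¬ ((xc p + 1ℤ , yc p) ∈S S)
  ⊎ ¬ ((xc p , yc p - 1ℤ) ∈S S)
  ⊎ ¬ ((xc p + 1ℤ , yc p - 1ℤ) ∈S S))

_<lex_ : Point → Point → Set
p <lex q = (xc p < xc q) ⊎ ((xc p ≡ xc q) × (yc p < yc q))

IsMaxX : PointSet → ℤ → Set
IsMaxX S m = (∃[ p ] (p ∈S S × xc p ≡ m)) × (∀ p → p ∈S S → xc p ≤ m)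

IsMaxY : PointSet → ℤ → Set
IsMaxY S m = (∃[ p ] (p ∈S S × yc p ≡ m)) × (∀ p → p ∈S S → yc p ≤ m)

-- Descending along A1 from any point of S ends at the origin, and climbing along A2
-- (played against points attaining xmax and ymax) ends at (xmax, ymax); these two
-- lower-boundary points are the lexicographically least and greatest points of S.
-- Lexicographically consecutive boundary points are ⊂-comparable because no point Q
-- of S lies strictly below-right of a boundary point P: by induction along A1, such
-- a Q forces the point below P into S, and A2 against Q then also puts the points
-- right of P and right of that one into S, so P would not be on the lower boundary.

module Submission where

open import Defs
open import Data.Integer using (ℤ; 0ℤ)
open import Data.Product using (_×_; _,_)
open import Data.List using (List; head; last)
open import Data.List.Membership.Propositional using (_∈_)
open import Data.List.Relation.Unary.Linked using (Linked)
open import Data.Maybe using (just)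
open import Function.Bundles using (_⇔_)
open import Relation.Binary.PropositionalEquality using (_≡_)

open import Data.Empty using (⊥-elim)
open import Data.Integer using (_+_; _-_; -_; _≤_; _<_; 1ℤ; +_; ∣_∣; suc)
open import Data.Integer.Properties
open import Data.Integer.Tactic.RingSolver using (solve-∀)
open import Data.List.Extrema ≤-totalOrder using (argmin; f[argmin]≤f[xs])
open import Data.List.Relation.Unary.All as All using (All; _∷_)
open import Data.List.Relation.Unary.AllPairs using (_∷_)
open import Data.List.Relation.Unary.Any using (here; there)
open import Data.List.Relation.Unary.Linked using ([-]; _∷_)
open import Data.List.Relation.Unary.Linked.Properties using (Linked⇒AllPairs)
open import Data.Nat as ℕ using (ℕ)
open import Data.Product using (proj₁; proj₂)
open import Data.Product.Properties using (≡-dec)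
open import Data.Product.Relation.Binary.Lex.Strict using (×-transitive)
open import Data.Sum using (_⊎_; inj₁; inj₂)
open import Function using (_∘_)
open import Function.Bundles using (Equivalence)
open import Level using (Level)
open import Relation.Binary using (Rel; Transitive)
open import Relation.Binary.PropositionalEquality
  using (_≢_; refl; sym; cong; cong₂; subst; isEquivalence; resp₂)
open import Relation.Nullary using (¬_; yes; no)
open import Relation.Unary using (Pred)

private
  variable
    a ℓ ℓ′ p : Level
    A : Set a

i-1<i : ∀ i → i - 1ℤ < i
i-1<i i = i≤pred[j]⇒i<j (≤-reflexive (+-comm i (- 1ℤ)))

i<i+1 : ∀ i → i < i + 1ℤ
i<i+1 i = suc[i]≤j⇒i<j (≤-reflexive (+-comm 1ℤ i))

i<j⇒i≤j-1 : ∀ {i j} → i < j → i ≤ j - 1ℤ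
i<j⇒i≤j-1 {j = j} i<j = ≤-trans (i<j⇒i≤pred[j] i<j) (≤-reflexive (+-comm (- 1ℤ) j))

i-1+1≡i : ∀ i → i - 1ℤ + 1ℤ ≡ i
i-1+1≡i = solve-∀

module _ (P : Pred A p) (f : A → ℤ) (xs : List A) where

  -- Well founded because f is bounded below on the finite list xs.
  ∈-measure-rec : (∀ x → x ∈ xs → (∀ y → y ∈ xs → f y < f x → P y) → P x) →
                  ∀ x → x ∈ xs → P x
  ∈-measure-rec rec x x∈xs =
    bounded (ℕ.suc ∣ f x - m ∣) x x∈xs
      (subst (λ k → f x - m < suc k) (sym (0≤i⇒+∣i∣≡i (m≤f x∈xs))) (suc[i]≤j⇒i<j ≤-refl))
    where
    m : ℤ
    m = f (argmin f x xs)

    m≤f : ∀ {y} → y ∈ xs → 0ℤ ≤ f y - m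
    m≤f y∈xs = i≤j⇒0≤j-i (All.lookup (f[argmin]≤f[xs] {f = f} x xs) y∈xs)

    bounded : ∀ n y → y ∈ xs → f y - m < + n → P y
    bounded ℕ.zero    y y∈xs fy<m = ⊥-elim (<⇒≱ fy<m (m≤f y∈xs))
    bounded (ℕ.suc n) y y∈xs fy<m+n+1 = rec y y∈xs λ z z∈xs fz<fy →
      bounded n z z∈xs (<-≤-trans (+-monoˡ-< (- m) fz<fy) (i<j⇒i≤pred[j] fy<m+n+1))

module _ {R : Rel A ℓ} where

  head-of-minimum : Transitive R → ∀ {x xs} → Linked R xs → x ∈ xs →
                    (∀ {y} → y ∈ xs → ¬ R y x) → head xs ≡ just x
  head-of-minimum _     _      (here refl)  _       = refl
  head-of-minimum trans sorted (there x∈ys) minimal with Linked⇒AllPairs trans sorted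
  ... | Ry[ys] ∷ _ = ⊥-elim (minimal (here refl) (All.lookup Ry[ys] x∈ys))

  last-of-maximum : ∀ {x xs} → Linked R xs → x ∈ xs →
                    (∀ {y} → y ∈ xs → ¬ R x y) → last xs ≡ just x
  last-of-maximum [-]          (here refl)   _       = refl
  last-of-maximum (Rxy ∷ _)    (here refl)   maximal = ⊥-elim (maximal (there (here refl)) Rxy)
  last-of-maximum (_ ∷ sorted) (there x∈xs) maximal = last-of-maximum sorted x∈xs (maximal ∘ there)

  linked-map-All : ∀ {R′ : Rel A ℓ′} {P : Pred A p} →
                   (∀ {x y} → P x → P y → R x y → R′ x y) →
                   ∀ {xs} → All P xs → Linked R xs → Linked R′ xs
  linked-map-All f _                Linked.[]   = Linked.[]
  linked-map-All f _                [-]         = [-]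
  linked-map-All f (Px ∷ Pys@(Py ∷ _)) (Rxy ∷ sorted) = f Px Py Rxy ∷ linked-map-All f Pys sorted

<lex-trans : Transitive _<lex_
<lex-trans = ×-transitive {_≈₁_ = _≡_} {_<_} {_<_} isEquivalence (resp₂ _<_) <-trans <-trans

left right down up : Point → Point
left  p = (xc p - 1ℤ , yc p)
right p = (xc p + 1ℤ , yc p)
down  p = (xc p , yc p - 1ℤ)
up    p = (xc p , yc p + 1ℤ)

size : Point → ℤ
size p = xc p + yc p

size-left : ∀ p → size (left p) < size p
size-left p = +-monoˡ-< (yc p) (i-1<i (xc p))

size-down : ∀ p → size (down p) < size p
size-down p = +-monoʳ-< (xc p) (i-1<i (yc p))

size-right : ∀ p → size p < size (right p)
size-right p = +-monoˡ-< (yc p) (i<i+1 (xc p))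

size-up : ∀ p → size p < size (up p)
size-up p = +-monoʳ-< (xc p) (i<i+1 (yc p))

_↘_ : Point → Point → Set
P ↘ Q = xc P < xc Q × yc Q < yc P

origin : Point
origin = (0ℤ , 0ℤ)

module Antimatroidal (S : PointSet) (a1 : A1 S) (a2 : A2 S) where

  A2-successor : ∀ {P Q} → P ∈ S → Q ∈ S → ¬ P ⊆ₚ Q → right Q ∈ S ⊎ up Q ∈ S
  A2-successor {P} {Q} P∈S Q∈S P⊈Q
    with a2 P Q P∈S Q∈S P⊈Q | ≤-total (xc P) (xc Q) | ≤-total (yc P) (yc Q)
  ... | _     , _   , _      | inj₁ xP≤xQ | inj₁ yP≤yQ = ⊥-elim (P⊈Q (xP≤xQ , yP≤yQ))
  ... | _     , up∈ , _      | inj₁ xP≤xQ | inj₂ yQ≤yP = inj₂ (up∈ xP≤xQ yQ≤yP)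
  ... | _     , _   , right∈ | inj₂ xQ≤xP | inj₁ yP≤yQ = inj₁ (right∈ xQ≤xP yP≤yQ)
  ... | succ∈ , _   , _      | inj₂ xQ≤xP | inj₂ yQ≤yP = succ∈ xQ≤xP yQ≤yP

  A2-right : ∀ {P Q} → P ∈ S → Q ∈ S → xc Q < xc P → yc P ≤ yc Q → right Q ∈ S
  A2-right P∈S Q∈S xQ<xP yP≤yQ =
    proj₂ (proj₂ (a2 _ _ P∈S Q∈S (<⇒≱ xQ<xP ∘ proj₁))) (<⇒≤ xQ<xP) yP≤yQ

  A1-rec : (Π : Pred Point p) →
           (∀ {P} → P ∈ S →
              P ≡ origin ⊎ (left P ∈ S × Π (left P)) ⊎ (down P ∈ S × Π (down P)) → Π P) →
           ∀ {P} → P ∈ S → Π P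
  A1-rec Π step {P} = ∈-measure-rec Π size S (λ P P∈S ih → step P∈S (descend P P∈S ih)) P
    where
    descend : ∀ P → P ∈ S → (∀ Q → Q ∈ S → size Q < size P → Π Q) →
              P ≡ origin ⊎ (left P ∈ S × Π (left P)) ⊎ (down P ∈ S × Π (down P))
    descend P P∈S ih with ≡-dec _≟_ _≟_ P origin
    ... | yes P≡0 = inj₁ P≡0
    ... | no P≢0 with a1 P P∈S P≢0
    ...   | inj₁ left∈S = inj₂ (inj₁ (left∈S , ih (left P) left∈S (size-left P)))
    ...   | inj₂ down∈S = inj₂ (inj₂ (down∈S , ih (down P) down∈S (size-down P)))

  coords-nonneg : ∀ {P} → P ∈ S → 0ℤ ≤ xc P × 0ℤ ≤ yc P
  coords-nonneg = A1-rec (λ P → 0ℤ ≤ xc P × 0ℤ ≤ yc P) λ where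
    _ (inj₁ refl)                            → ≤-refl , ≤-refl
    _ (inj₂ (inj₁ (_ , 0≤x-1 , 0≤y)))        → ≤-trans 0≤x-1 (<⇒≤ (i-1<i _)) , 0≤y
    _ (inj₂ (inj₂ (_ , 0≤x , 0≤y-1)))        → 0≤x , ≤-trans 0≤y-1 (<⇒≤ (i-1<i _))

  origin-∈ : ∀ {P} → P ∈ S → origin ∈ S
  origin-∈ = A1-rec (λ _ → origin ∈ S) λ where
    P∈S (inj₁ refl)                 → P∈S
    _   (inj₂ (inj₁ (_ , origin∈S))) → origin∈S
    _   (inj₂ (inj₂ (_ , origin∈S))) → origin∈S

  ↘⇒down-∈ : ∀ {P Q} → P ∈ S → Q ∈ S → P ↘ Q → down P ∈ S
  ↘⇒down-∈ {Q = Q} P∈S Q∈S = A1-rec Down step P∈S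
    where
    Down : Pred Point _
    Down P = P ↘ Q → down P ∈ S

    step : ∀ {P} → P ∈ S →
           P ≡ origin ⊎ (left P ∈ S × Down (left P)) ⊎ (down P ∈ S × Down (down P)) → Down P
    step _ (inj₁ refl) (_ , yQ<0) = ⊥-elim (<⇒≱ yQ<0 (proj₂ (coords-nonneg Q∈S)))
    step {P} _ (inj₂ (inj₁ (_ , ih))) (xP<xQ , yQ<yP) =
      subst (λ x → (x , yc P - 1ℤ) ∈ S) (i-1+1≡i (xc P))
        (A2-right Q∈S (ih (xP-1<xQ , yQ<yP)) xP-1<xQ (i<j⇒i≤j-1 yQ<yP))
      where
      xP-1<xQ : xc P - 1ℤ < xc Q
      xP-1<xQ = <-trans (i-1<i (xc P)) xP<xQ
    step _ (inj₂ (inj₂ (down∈S , _))) _ = down∈S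

  InLower⇒¬↘ : ∀ {P Q} → InLower S P → Q ∈ S → ¬ P ↘ Q
  InLower⇒¬↘ (P∈S , P-on-boundary) Q∈S P↘Q@(xP<xQ , yQ<yP) with P-on-boundary
  ... | inj₁ right∉S         = right∉S (A2-right Q∈S P∈S xP<xQ (<⇒≤ yQ<yP))
  ... | inj₂ (inj₁ down∉S)   = down∉S (↘⇒down-∈ P∈S Q∈S P↘Q)
  ... | inj₂ (inj₂ corner∉S) =
    corner∉S (A2-right Q∈S (↘⇒down-∈ P∈S Q∈S P↘Q) xP<xQ (i<j⇒i≤j-1 yQ<yP))

  InLower-<lex⇒⊂ₚ : ∀ {P Q} → InLower S P → Q ∈ S → P <lex Q → P ⊂ₚ Q
  InLower-<lex⇒⊂ₚ lowerP Q∈S (inj₁ xP<xQ) =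
    (<⇒≤ xP<xQ , ≮⇒≥ (λ yQ<yP → InLower⇒¬↘ lowerP Q∈S (xP<xQ , yQ<yP))) ,
    <⇒≢ xP<xQ ∘ cong xc
  InLower-<lex⇒⊂ₚ _ _ (inj₂ (xP≡xQ , yP<yQ)) =
    (≤-reflexive xP≡xQ , <⇒≤ yP<yQ) , <⇒≢ yP<yQ ∘ cong yc

  origin-InLower : origin ∈ S → InLower S origin
  origin-InLower origin∈S = origin∈S , inj₂ (inj₁ λ down∈S → <⇒≱ (i-1<i 0ℤ) (proj₂ (coords-nonneg down∈S)))

  ≮lex-origin : ∀ {P} → P ∈ S → ¬ P <lex origin
  ≮lex-origin P∈S (inj₁ xP<0)       = <⇒≱ xP<0 (proj₁ (coords-nonneg P∈S))
  ≮lex-origin P∈S (inj₂ (_ , yP<0)) = <⇒≱ yP<0 (proj₂ (coords-nonneg P∈S))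

  module _ {xmax ymax : ℤ} (isMaxX : IsMaxX S xmax) (isMaxY : IsMaxY S ymax) where

    top : Point
    top = (xmax , ymax)

    ≤xmax : ∀ {P} → P ∈ S → xc P ≤ xmax
    ≤xmax = proj₂ isMaxX _

    ≤ymax : ∀ {P} → P ∈ S → yc P ≤ ymax
    ≤ymax = proj₂ isMaxY _

    -- Some point attaining xmax or ymax is not below P ≠ top, and A2 against it lifts P.
    successor : ∀ {P} → P ∈ S → P ≢ top → right P ∈ S ⊎ up P ∈ S
    successor {P} P∈S P≢top with proj₁ isMaxX | proj₁ isMaxY
    ... | X , X∈S , refl | Y , Y∈S , refl with xc X ≤? xc P | yc Y ≤? yc P
    ... | yes xX≤xP | yes yY≤yP =
      ⊥-elim (P≢top (cong₂ _,_ (≤-antisym (≤xmax P∈S) xX≤xP) (≤-antisym (≤ymax P∈S) yY≤yP)))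
    ... | no xX≰xP | _        = A2-successor X∈S P∈S (xX≰xP ∘ proj₁)
    ... | yes _    | no yY≰yP = A2-successor Y∈S P∈S (yY≰yP ∘ proj₂)

    top-∈ : ∀ {P} → P ∈ S → top ∈ S
    top-∈ {P} = ∈-measure-rec (λ _ → top ∈ S) (-_ ∘ size) S step P
      where
      step : ∀ P → P ∈ S → (∀ Q → Q ∈ S → - size Q < - size P → top ∈ S) → top ∈ S
      step P P∈S ih with ≡-dec _≟_ _≟_ P top
      ... | yes refl  = P∈S
      ... | no P≢top with successor P∈S P≢top
      ...   | inj₁ right∈S = ih (right P) right∈S (neg-mono-< (size-right P))
      ...   | inj₂ up∈S    = ih (up P) up∈S (neg-mono-< (size-up P))

    top-InLower : top ∈ S → InLower S top
    top-InLower top∈S = top∈S , inj₁ λ right∈S → <⇒≱ (i<i+1 xmax) (≤xmax right∈S)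

    top-≮lex : ∀ {P} → P ∈ S → ¬ top <lex P
    top-≮lex P∈S (inj₁ xmax<xP)       = <⇒≱ xmax<xP (≤xmax P∈S)
    top-≮lex P∈S (inj₂ (_ , ymax<yP)) = <⇒≱ ymax<yP (≤ymax P∈S)

lemma2 : (S : PointSet) → IsAntimatroidal S →
    (xmax ymax : ℤ) → IsMaxX S xmax → IsMaxY S ymax →
    (L : List Point) → Linked _<lex_ L → (∀ p → (p ∈ L) ⇔ InLower S p) →
    (head L ≡ just (0ℤ , 0ℤ)) × (last L ≡ just (xmax , ymax)) × Linked _⊂ₚ_ L
lemma2 S ((_ , P∈S) , a1 , a2) xmax ymax isMaxX isMaxY L sorted L≡lower =
  head-of-minimum <lex-trans sorted (lower⇒∈L (origin-InLower origin∈S)) (≮lex-origin ∘ ∈L⇒∈S) ,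
  last-of-maximum sorted (lower⇒∈L (top-InLower isMaxX isMaxY top∈S)) (top-≮lex isMaxX isMaxY ∘ ∈L⇒∈S) ,
  linked-map-All (λ lowerP lowerQ → InLower-<lex⇒⊂ₚ lowerP (proj₁ lowerQ))
    (All.tabulate (Equivalence.to (L≡lower _))) sorted
  where
  open Antimatroidal S a1 a2

  origin∈S : origin ∈ S
  origin∈S = origin-∈ P∈S

  top∈S : (xmax , ymax) ∈ S
  top∈S = top-∈ isMaxX isMaxY P∈S

  lower⇒∈L : ∀ {P} → InLower S P → P ∈ L
  lower⇒∈L = Equivalence.from (L≡lower _)

  ∈L⇒∈S : ∀ {P} → P ∈ L → P ∈ S
  ∈L⇒∈S = proj₁ ∘ Equivalence.to (L≡lower _)
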